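{- The theory of the (Rado) random graph has $\mathbf{c}_2$-TP.
   Context: The random graph is the countable graph (language $\{R\}$) satisfying the extension axioms: for any disjoint finite sets $A,B$ of vertices there is a vertex adjacent to all of $A$ and none of $B$. $\mathbf{c}_2$ is the Fraïssé limit of finite linear orders each of whose elements is colored by exactly one of two unary predicates (colors). $\mathbf{c}_2^{<\omega}$ is the tree of functions from finite initial segments of $\omega$ to $\mathbf{c}_2$, with branches $\mathbf{c}_2^\omega$. For a complete quantifier-free $n$-type $q$ in the language of $\mathbf{c}_2$, $\{\varphi(x,a_i):i\in\mathbf{c}_2\}$ is $q$-inconsistent if whenever $(i_1,\dots,i_n)\models q$, $\{\varphi(x,a_{i_1}),\dots,\varphi(x,a_{i_n})\}$ is inconsistent. A formula $\varphi(x,y)$ has $\mathbf{c}_2$-TP if there are tuples $(a_\eta)_{\eta\in\mathbf{c}_2^{<\omega}}$ and such a $q$ such that for every $\beta\in\mathbf{c}_2^\omega$, $\{\varphi(x,a_{\beta|_i}):i<\omega\}$ is consistent and for every $\eta$, $\{\varphi(x,a_{\eta^\frown i}):i\in\mathbf{c}_2\}$ is $q$-inconsistent. A theory has $\mathbf{c}_2$-TP if some formula does. -}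

module Defs where

open import Data.Nat using (ℕ; zero; suc; _+_)
open import Data.Fin using (Fin)
import Data.Fin as F
open import Data.List using (List; []; _∷_; map; upTo; _∷ʳ_)
open import Data.List.Membership.Propositional using (_∈_)
open import Data.List.Relation.Unary.All using (All)
open import Data.Product using (Σ; _×_; _,_; ∃; ∃-syntax)
open import Data.Sum using (_⊎_)
open import Data.Empty using (⊥)
open import Data.Unit using (⊤)
open import Relation.Nullary using (¬_)
open import Relation.Binary.PropositionalEquality using (_≡_)
open import Relation.Binary.Structures using (IsStrictTotalOrder)
open import Function.Bundles using (_⇔_; _↔_; Inverse)
open import Data.Vec.Functional using (Vector) renaming (_++_ to _++ᵛ_; _∷_ to _∷ᵛ_)

record RandomGraph : Set₁ where
  field
    V      : Set
    R      : V → V → Set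
    R-sym  : ∀ {u v} → R u v → R v u
    R-irr  : ∀ {v} → ¬ R v v
    enum   : ℕ → V
    enum-surj : ∀ v → ∃[ n ] enum n ≡ v
    extension : (A B : List V) → (∀ v → v ∈ A → v ∈ B → ⊥) →
                ∃[ z ] (All (λ a → R z a) A × All (λ b → ¬ R z b) B)

-- First-order formulas in the language {R} (with equality),
-- de Bruijn style: Formula n has free variables indexed by Fin n.

data Formula : ℕ → Set where
  rel  : ∀ {n} → Fin n → Fin n → Formula n
  eql  : ∀ {n} → Fin n → Fin n → Formula n
  tru  : ∀ {n} → Formula n
  fls  : ∀ {n} → Formula n
  neg  : ∀ {n} → Formula n → Formula n
  conj : ∀ {n} → Formula n → Formula n → Formula n
  disj : ∀ {n} → Formula n → Formula n → Formula n
  impl : ∀ {n} → Formula n → Formula n → Formula n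
  exi  : ∀ {n} → Formula (suc n) → Formula n
  all  : ∀ {n} → Formula (suc n) → Formula n

module _ (G : RandomGraph) where
  open RandomGraph G

  Sat : ∀ {n} → Formula n → Vector V n → Set
  Sat (rel i j)  ρ = R (ρ i) (ρ j)
  Sat (eql i j)  ρ = ρ i ≡ ρ j
  Sat tru        ρ = ⊤
  Sat fls        ρ = ⊥
  Sat (neg φ)    ρ = ¬ Sat φ ρ
  Sat (conj φ ψ) ρ = Sat φ ρ × Sat ψ ρ
  Sat (disj φ ψ) ρ = Sat φ ρ ⊎ Sat ψ ρ
  Sat (impl φ ψ) ρ = Sat φ ρ → Sat ψ ρ
  Sat (exi φ)    ρ = Σ V (λ v → Sat φ (v ∷ᵛ ρ))
  Sat (all φ)    ρ = (v : V) → Sat φ (v ∷ᵛ ρ)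

-- c₂ : the Fraïssé limit of finite linear orders whose elements are
-- coloured by exactly one of two colours (colour given as Fin 2).

record C2 : Set₁ where
  field
    Carrier : Set
    _<_     : Carrier → Carrier → Set
    colour  : Carrier → Fin 2
    isSTO   : IsStrictTotalOrder _≡_ _<_
    enum      : ℕ → Carrier
    enum-surj : ∀ c → ∃[ n ] enum n ≡ c
    age : (n : ℕ) (col : Fin n → Fin 2) →
          Σ (Fin n → Carrier) λ f → ((∀ i j → i F.< j → f i < f j) × (∀ i → colour (f i) ≡ col i))

  SameQfType : ∀ {n} → (Fin n → Carrier) → (Fin n → Carrier) → Set
  SameQfType c d =
    (∀ i j → (c i < c j ⇔ d i < d j)) ×
    (∀ i j → (c i ≡ c j ⇔ d i ≡ d j)) ×
    (∀ i → colour (c i) ≡ colour (d i))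

  field
    ultrahomogeneous : ∀ n (a b : Fin n → Carrier) → SameQfType a b →
      Σ (Carrier ↔ Carrier) λ σ →
        (∀ x y → (x < y ⇔ Inverse.to σ x < Inverse.to σ y)) ×
        (∀ x → colour (Inverse.to σ x) ≡ colour x) ×
        (∀ i → Inverse.to σ (a i) ≡ b i)

module _ (G : RandomGraph) (C : C2) where
  open RandomGraph G using (V)
  open C2 C using (Carrier; SameQfType)

  -- nodes of c₂^{<ω}: finite sequences; η ⌢ i is η ∷ʳ i
  -- β|ᵢ for a branch β : ℕ → Carrier
  restrict : (ℕ → Carrier) → ℕ → List Carrier
  restrict β i = map β (upTo i)

  -- φ(x;y) with |x| = k, |y| = m has c₂-TP, witnessed by the parameters
  -- a and by the complete qf n-type q = qftp(c)
  C2TPWitness : (k m : ℕ) → Formula (k + m) →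
                (List Carrier → Vector V m) → (n : ℕ) → (Fin n → Carrier) → Set
  C2TPWitness k m φ a n c =
    -- every branch is consistent (finitely satisfiable)
    (∀ (β : ℕ → Carrier) (is : List ℕ) →
       ∃[ x ] All (λ i → Sat G φ (x ++ᵛ a (restrict β i))) is) ×
    -- every set of children is q-inconsistent
    (∀ (η : List Carrier) (d : Fin n → Carrier) → SameQfType c d →
       ¬ (∃[ x ] (∀ j → Sat G φ (x ++ᵛ a (η ∷ʳ d j)))))

  HasC2TP : Set
  HasC2TP = ∃[ k ] ∃[ m ] Σ (Formula (k + m)) λ φ →
            Σ (List Carrier → Vector V m) λ a →
            ∃[ n ] Σ (Fin n → Carrier) λ c → C2TPWitness k m φ a n c

{-# OPTIONS --safe #-}

-- Take φ(x; y₀ y₁) = R(x, y₀) ∧ ¬ R(x, y₁) and fix pairwise distinct vertices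
-- v(ℓ, b) for ℓ ∈ ℕ and b ∈ {0, 1}.  A node η of length ℓ whose last entry has
-- colour b gets the parameters (v(ℓ, b), v(ℓ, 1 - b)).  Along a branch each
-- level contributes one positive and one negative parameter, all distinct, so
-- the extension axiom makes the branch consistent.  For q the type of a pair
-- coloured 0 and 1, two children realising q ask x to be both adjacent and
-- non-adjacent to v(ℓ + 1, 0).

module Submission where

open import Defs
open import Data.Nat using (ℕ; zero; suc; _+_; _*_; _<_)
open import Data.Nat.Properties using (<-cmp; m<1+n⇒m<n∨m≡n; +-cancelˡ-≡; *-cancelʳ-≡)
open import Data.Nat.DivMod using (_%_; [m+kn]%n≡m%n; m<n⇒m%n≡m)
open import Data.Fin using (Fin; toℕ; opposite) renaming (zero to fz; suc to fs)
open import Data.Fin.Properties using (toℕ-injective; toℕ<n)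
open import Data.List using (List; []; _∷_; map; upTo; _∷ʳ_; length; foldl)
open import Data.List.Properties using (length-map; length-upTo; length-++; foldl-∷ʳ)
open import Data.List.Membership.Propositional using (_∈_)
open import Data.List.Membership.Propositional.Properties using (∈-map⁻)
open import Data.List.Relation.Unary.All using (All; lookup; zip)
open import Data.List.Relation.Unary.All.Properties using (map⁻)
open import Data.List.Relation.Unary.Any using (here; there)
open import Data.Product using (_×_; _,_; Σ-syntax; proj₁; proj₂)
open import Data.Sum using (inj₁; inj₂)
open import Data.Empty using (⊥; ⊥-elim)
open import Relation.Nullary using (¬_)
open import Relation.Binary.PropositionalEquality
  using (_≡_; _≢_; refl; sym; trans; cong; cong₂; subst; module ≡-Reasoning)
open import Relation.Binary.Definitions using (tri<; tri≈; tri>)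
open import Function.Definitions using (Injective)
open import Data.Vec.Functional using (Vector) renaming (_++_ to _++ᵛ_; _∷_ to _∷ᵛ_; [] to []ᵛ)

opposite-fixed-point-free : (b : Fin 2) → b ≢ opposite b
opposite-fixed-point-free fz ()
opposite-fixed-point-free (fs fz) ()

pairing : ℕ × Fin 2 → ℕ
pairing (ℓ , b) = toℕ b + ℓ * 2

pairing-injective : Injective _≡_ _≡_ pairing
pairing-injective {ℓ , b} {ℓ′ , b′} eq with toℕ-injective colours-equal
  where
  colours-equal : toℕ b ≡ toℕ b′
  colours-equal = begin
    toℕ b                 ≡⟨ m<n⇒m%n≡m (toℕ<n b) ⟨
    toℕ b % 2             ≡⟨ [m+kn]%n≡m%n (toℕ b) ℓ 2 ⟨
    pairing (ℓ , b) % 2   ≡⟨ cong (_% 2) eq ⟩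
    pairing (ℓ′ , b′) % 2 ≡⟨ [m+kn]%n≡m%n (toℕ b′) ℓ′ 2 ⟩
    toℕ b′ % 2            ≡⟨ m<n⇒m%n≡m (toℕ<n b′) ⟩
    toℕ b′                ∎
    where open ≡-Reasoning
... | refl = cong (_, b) (*-cancelʳ-≡ ℓ ℓ′ 2 (+-cancelˡ-≡ (toℕ b) _ _ eq))

module _ (G : RandomGraph) where
  open RandomGraph G

  earlier : ℕ → List V
  fresh : ℕ → V

  earlier zero = []
  earlier (suc n) = fresh n ∷ earlier n

  fresh n = proj₁ (extension (earlier n) [] (λ _ _ ()))

  fresh-adjacent-earlier : ∀ n → All (R (fresh n)) (earlier n)
  fresh-adjacent-earlier n = proj₁ (proj₂ (extension (earlier n) [] (λ _ _ ())))

  fresh∈earlier : ∀ {k n} → k < n → fresh k ∈ earlier n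
  fresh∈earlier {n = suc n} k<1+n with m<1+n⇒m<n∨m≡n k<1+n
  ... | inj₁ k<n  = there (fresh∈earlier k<n)
  ... | inj₂ refl = here refl

  fresh-adjacent : ∀ {k n} → k < n → R (fresh n) (fresh k)
  fresh-adjacent k<n = lookup (fresh-adjacent-earlier _) (fresh∈earlier k<n)

  fresh-injective : Injective _≡_ _≡_ fresh
  fresh-injective {p} {q} eq with <-cmp p q
  ... | tri< p<q _ _ = ⊥-elim (R-irr (subst (R (fresh q)) eq (fresh-adjacent p<q)))
  ... | tri≈ _ p≡q _ = p≡q
  ... | tri> _ _ q<p = ⊥-elim (R-irr (subst (R (fresh p)) (sym eq) (fresh-adjacent q<p)))

  vertex : ℕ × Fin 2 → V
  vertex i = fresh (pairing i)

  vertex-injective : Injective _≡_ _≡_ vertex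
  vertex-injective eq = pairing-injective (fresh-injective eq)

  adjacent-not-adjacent : Formula (1 + 2)
  adjacent-not-adjacent = conj (rel fz (fs fz)) (neg (rel fz (fs (fs fz))))

  positive-negative-disjoint : {I : Set} (ℓ : I → ℕ) (b : I → Fin 2) → Injective _≡_ _≡_ ℓ →
    ∀ is v → v ∈ map (λ i → vertex (ℓ i , b i)) is →
             v ∈ map (λ i → vertex (ℓ i , opposite (b i))) is → ⊥
  positive-negative-disjoint ℓ b ℓ-injective is v v∈pos v∈neg
    with ∈-map⁻ _ v∈pos | ∈-map⁻ _ v∈neg
  ... | i , _ , v≡pos | j , _ , v≡neg
    with vertex-injective {ℓ i , b i} {ℓ j , opposite (b j)} (trans (sym v≡pos) v≡neg)
  ... | same-index with ℓ-injective (cong proj₁ same-index)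
  ... | refl = opposite-fixed-point-free (b i) (cong proj₂ same-index)

  module _ (C : C2) where
    open C2 C

    -- The root, never a child, gets the junk colour 0.
    lastColour : List Carrier → Fin 2
    lastColour = foldl (λ _ x → colour x) fz

    parameters : List Carrier → Vector V 2
    parameters η = vertex (length η , lastColour η)
                ∷ᵛ vertex (length η , opposite (lastColour η)) ∷ᵛ []ᵛ

    length-restrict : ∀ β i → length (restrict G C β i) ≡ i
    length-restrict β i = trans (length-map β (upTo i)) (length-upTo i)

    branch-consistent : ∀ β is →
      Σ[ x ∈ Vector V 1 ] All (λ i → Sat G adjacent-not-adjacent (x ++ᵛ parameters (restrict G C β i))) is
    branch-consistent β is
      with extension (map (λ i → vertex (ℓ i , b i)) is)
                     (map (λ i → vertex (ℓ i , opposite (b i))) is)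
                     (positive-negative-disjoint ℓ b ℓ-injective is)
      where
      ℓ : ℕ → ℕ
      ℓ i = length (restrict G C β i)
      b : ℕ → Fin 2
      b i = lastColour (restrict G C β i)
      ℓ-injective : Injective _≡_ _≡_ ℓ
      ℓ-injective {i} {j} eq = trans (sym (length-restrict β i)) (trans eq (length-restrict β j))
    ... | x , adjacent , non-adjacent = (λ _ → x) , zip (map⁻ adjacent , map⁻ non-adjacent)

    children-inconsistent : ∀ η (d : Fin 2 → Carrier) → (∀ j → colour (d j) ≡ j) →
      ¬ (Σ[ x ∈ Vector V 1 ] ∀ j → Sat G adjacent-not-adjacent (x ++ᵛ parameters (η ∷ʳ d j)))
    children-inconsistent η d colour-d (x , sat) =
      proj₂ (sat (fs fz)) (subst (R (x fz)) same-vertex (proj₁ (sat fz)))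
      where
      lastColour-child : ∀ j → lastColour (η ∷ʳ d j) ≡ j
      lastColour-child j = trans (foldl-∷ʳ _ fz (d j) η) (colour-d j)
      same-length : length (η ∷ʳ d fz) ≡ length (η ∷ʳ d (fs fz))
      same-length = trans (length-++ η) (sym (length-++ η))
      same-vertex : vertex (length (η ∷ʳ d fz) , lastColour (η ∷ʳ d fz))
                  ≡ vertex (length (η ∷ʳ d (fs fz)) , opposite (lastColour (η ∷ʳ d (fs fz))))
      same-vertex = cong vertex (cong₂ _,_ same-length
        (trans (lastColour-child fz) (sym (cong opposite (lastColour-child (fs fz))))))

proposition5p3 : (G : RandomGraph) (C : C2) → HasC2TP G C
proposition5p3 G C =
  1 , 2 , adjacent-not-adjacent G , parameters G C , 2 , pair ,
  branch-consistent G C ,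
  λ η d same-type → children-inconsistent G C η d
    (λ j → trans (sym (proj₂ (proj₂ same-type) j)) (pair-coloured j))
  where
  open C2 C
  pair : Fin 2 → Carrier
  pair = proj₁ (age 2 (λ j → j))
  pair-coloured : ∀ j → colour (pair j) ≡ j
  pair-coloured = proj₂ (proj₂ (age 2 (λ j → j)))
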